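{- Let $\tau$ be a functor in the sense described in the context, let $\alpha,\beta,\gamma$ be representable types, and let $f:\beta\to\gamma$ and $g:\alpha\to\beta$ be continuous. Then $\mathrm{fmap}_{\alpha,\gamma}(f\circ g)=\mathrm{fmap}_{\beta,\gamma}(f)\circ\mathrm{fmap}_{\alpha,\beta}(g)$.
   Context: All types are pointed cpos (pcpos): partial orders with a least element $\bot$ in which every countable increasing chain has a least upper bound. $\alpha\to\beta$ denotes the pcpo of continuous functions from $\alpha$ to $\beta$, ordered pointwise; $\circ$ is composition and $\mathrm{id}$ the identity. Fix a pcpo $\mathcal{U}$ (the universal domain). A representable type is a pcpo $\alpha$ together with continuous maps $\mathrm{emb}_\alpha:\alpha\to\mathcal{U}$ and $\mathrm{proj}_\alpha:\mathcal{U}\to\alpha$ such that $\mathrm{proj}_\alpha\circ\mathrm{emb}_\alpha=\mathrm{id}_\alpha$ and $\mathrm{emb}_\alpha\circ\mathrm{proj}_\alpha\sqsubseteq\mathrm{id}_{\mathcal{U}}$. $\mathcal{U}$ is representable with $\mathrm{emb}_{\mathcal{U}}=\mathrm{proj}_{\mathcal{U}}=\mathrm{id}_{\mathcal{U}}$. If $\alpha,\beta$ are representable, then $\alpha\to\beta$ is representable with $\mathrm{emb}_{\alpha\to\beta}(h)=\mathrm{in}(\mathrm{emb}_\beta\circ h\circ\mathrm{proj}_\alpha)$ and $\mathrm{proj}_{\alpha\to\beta}(u)=\mathrm{proj}_\beta\circ\mathrm{out}(u)\circ\mathrm{emb}_\alpha$. Here $\mathrm{in}:(\mathcal{U}\to\mathcal{U})\to\mathcal{U}$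 and $\mathrm{out}:\mathcal{U}\to(\mathcal{U}\to\mathcal{U})$ are fixed continuous maps with $\mathrm{out}\circ\mathrm{in}=\mathrm{id}$ and $\mathrm{in}\circ\mathrm{out}\sqsubseteq\mathrm{id}$. For representable $\alpha,\beta$, define $\mathrm{coerce}_{\alpha,\beta}=\mathrm{proj}_\beta\circ\mathrm{emb}_\alpha:\alpha\to\beta$ and $\mathrm{REP}(\alpha)=\mathrm{emb}_\alpha\circ\mathrm{proj}_\alpha$. Let $\mathcal{D}$ be the pcpo of deflations on $\mathcal{U}$, i.e. continuous $d:\mathcal{U}\to\mathcal{U}$ with $d\circ d=d\sqsubseteq\mathrm{id}_{\mathcal{U}}$, ordered pointwise; note $\mathrm{REP}(\alpha)\in\mathcal{D}$. A type constructor $\tau$ is given by a continuous map $T_\tau:\mathcal{D}\to\mathcal{D}$. For representable $\alpha$, the type $\tau\cdot\alpha$ is the sub-pcpo $\{u\in\mathcal{U}\mid T_\tau(\mathrm{REP}(\alpha))(u)=u\}$. It is represented with $\mathrm{emb}_{\tau\cdot\alpha}$ the inclusion and $\mathrm{proj}_{\tau\cdot\alpha}=T_\tau(\mathrm{REP}(\alpha))$, so $\mathrm{REP}(\tau\cdot\alpha)=T_\tau(\mathrm{REP}(\alpha))$. $\tau$ is a functor if it comes with a continuous $\underline{\mathrm{fmap}}:(\mathcal{U}\to\mathcal{U})\to(\tau\cdot\mathcal{U}\to\tau\cdot\mathcal{U})$ satisfying: (F1) for every $d\in\mathcal{D}$, $\mathrm{emb}_{\tau\cdot\mathcal{U}}\circ\underline{\mathrm{fmap}}(d)\circ\mathrm{proj}_{\tau\cdot\mathcal{U}}=T_\tau(d)$;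 (F2) $\underline{\mathrm{fmap}}(f\circ g)=\underline{\mathrm{fmap}}(f)\circ\underline{\mathrm{fmap}}(g)$ for all $f,g:\mathcal{U}\to\mathcal{U}$. For representable $\alpha,\beta$, the polymorphic map $\mathrm{fmap}_{\alpha,\beta}:(\alpha\to\beta)\to(\tau\cdot\alpha\to\tau\cdot\beta)$ is $\mathrm{fmap}_{\alpha,\beta}(f)=\mathrm{coerce}_{\tau\cdot\mathcal{U},\tau\cdot\beta}\circ\underline{\mathrm{fmap}}(\mathrm{emb}_\beta\circ f\circ\mathrm{proj}_\alpha)\circ\mathrm{coerce}_{\tau\cdot\alpha,\tau\cdot\mathcal{U}}$. -}

module Defs where

open import Data.Nat using (ℕ; suc)
open import Data.Product using (Σ; _,_; proj₁; proj₂; _×_)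

-- A partial order is represented (setoid style) by a
-- preorder _⊑_ whose equality is x ≈ y := x ⊑ y × y ⊑ x.

record Pcpo : Set₁ where
  field
    Carrier : Set
    _⊑_     : Carrier → Carrier → Set
    ⊑-refl  : ∀ {x} → x ⊑ x
    ⊑-trans : ∀ {x y z} → x ⊑ y → y ⊑ z → x ⊑ z
    ⊥       : Carrier
    ⊥-least : ∀ {x} → ⊥ ⊑ x
    ⊔       : (c : ℕ → Carrier) → (∀ n → c n ⊑ c (suc n)) → Carrier
    ⊔-ub    : ∀ c p n → c n ⊑ ⊔ c p
    ⊔-least : ∀ c p {x} → (∀ n → c n ⊑ x) → ⊔ c p ⊑ x

  infix 4 _≈_
  _≈_ : Carrier → Carrier → Set
  x ≈ y = (x ⊑ y) × (y ⊑ x)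

open Pcpo

-- Continuous functions: monotone and preserving lubs of chains
-- (the inequality ⊒ follows from monotonicity).

record Cont (A B : Pcpo) : Set where
  field
    fun  : Carrier A → Carrier B
    mono : ∀ {x y} → _⊑_ A x y → _⊑_ B (fun x) (fun y)
    cont : ∀ c p → _⊑_ B (fun (⊔ A c p)) (⊔ B (λ n → fun (c n)) (λ n → mono (p n)))

open Cont

idc : ∀ {A} → Cont A A
idc {A} = record { fun = λ x → x ; mono = λ p → p ; cont = λ c p → ⊑-refl A }

infixr 9 _∘c_
_∘c_ : ∀ {A B C} → Cont B C → Cont A B → Cont A C
_∘c_ {A} {B} {C} f g = record
  { fun  = λ x → fun f (fun g x)
  ; mono = λ p → mono f (mono g p)
  ; cont = λ c p → ⊑-trans C (mono f (cont g c p))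
                     (cont f (λ n → fun g (c n)) (λ n → mono g (p n)))
  }

infixr 0 _⇒_
_⇒_ : Pcpo → Pcpo → Pcpo
A ⇒ B = record
  { Carrier = Cont A B
  ; _⊑_     = λ f g → ∀ x → _⊑_ B (fun f x) (fun g x)
  ; ⊑-refl  = λ x → ⊑-refl B
  ; ⊑-trans = λ p q x → ⊑-trans B (p x) (q x)
  ; ⊥       = record { fun = λ _ → ⊥ B ; mono = λ _ → ⊑-refl B ; cont = λ c p → ⊥-least B }
  ; ⊥-least = λ x → ⊥-least B
  ; ⊔       = lubF
  ; ⊔-ub    = λ c p n x → ⊔-ub B (λ k → fun (c k) x) (λ k → p k x) n
  ; ⊔-least = λ c p q x → ⊔-least B (λ k → fun (c k) x) (λ k → p k x) (λ n → q n x)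
  }
  where
  lubF : (c : ℕ → Cont A B) → (∀ n x → _⊑_ B (fun (c n) x) (fun (c (suc n)) x)) → Cont A B
  lubF c p = record { fun = F ; mono = monoF ; cont = contF }
    where
    F : Carrier A → Carrier B
    F x = ⊔ B (λ k → fun (c k) x) (λ k → p k x)
    monoF : ∀ {x y} → _⊑_ A x y → _⊑_ B (F x) (F y)
    monoF {x} {y} q = ⊔-least B (λ k → fun (c k) x) (λ k → p k x)
      (λ n → ⊑-trans B (mono (c n) q) (⊔-ub B (λ k → fun (c k) y) (λ k → p k y) n))
    contF : ∀ xs qs → _⊑_ B (F (⊔ A xs qs)) (⊔ B (λ m → F (xs m)) (λ m → monoF (qs m)))
    contF xs qs = ⊔-least B _ _ (λ n →
      ⊑-trans B (cont (c n) xs qs)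
        (⊔-least B _ _ (λ m →
          ⊑-trans B (⊔-ub B (λ k → fun (c k) (xs m)) (λ k → p k (xs m)) n)
                    (⊔-ub B (λ m' → F (xs m')) (λ m' → monoF (qs m')) m))))

record Universal : Set₁ where
  field
    U      : Pcpo
    inU    : Cont (U ⇒ U) U
    outU   : Cont U (U ⇒ U)
    out∘in : _≈_ ((U ⇒ U) ⇒ (U ⇒ U)) (outU ∘c inU) idc
    in∘out : _⊑_ (U ⇒ U) (inU ∘c outU) idc

module _ (U : Pcpo) where

  IsDeflation : Cont U U → Set
  IsDeflation d = (_≈_ (U ⇒ U) (d ∘c d) d) × (_⊑_ (U ⇒ U) d idc)

  Defl : Pcpo
  Defl = record
    { Carrier = Σ (Cont U U) IsDeflation
    ; _⊑_     = λ d e → _⊑_ (U ⇒ U) (proj₁ d) (proj₁ e)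
    ; ⊑-refl  = λ x → ⊑-refl U
    ; ⊑-trans = λ p q x → ⊑-trans U (p x) (q x)
    ; ⊥       = ⊥ (U ⇒ U) , ((λ x → ⊑-refl U) , (λ x → ⊑-refl U)) , (λ x → ⊥-least U)
    ; ⊥-least = λ x → ⊥-least U
    ; ⊔       = lubD
    ; ⊔-ub    = λ c p → ⊔-ub (U ⇒ U) (λ n → proj₁ (c n)) p
    ; ⊔-least = λ c p {e} q → ⊔-least (U ⇒ U) (λ n → proj₁ (c n)) p {proj₁ e} q
    }
    where
    lubD : (c : ℕ → Σ (Cont U U) IsDeflation) →
           (∀ n → _⊑_ (U ⇒ U) (proj₁ (c n)) (proj₁ (c (suc n)))) →
           Σ (Cont U U) IsDeflation
    lubD c p = d , (idem , below)
      where
      d : Cont U U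
      d = ⊔ (U ⇒ U) (λ n → proj₁ (c n)) p
      below : _⊑_ (U ⇒ U) d idc
      below x = ⊔-least U _ _ (λ n → proj₂ (proj₂ (c n)) x)
      idem : _≈_ (U ⇒ U) (d ∘c d) d
      idem = (λ x → below (fun d x))
           , (λ x → ⊔-least U _ _ (λ n →
                ⊑-trans U (proj₂ (proj₁ (proj₂ (c n))) x)
                  (⊑-trans U (mono (proj₁ (c n)) (⊔-ub (U ⇒ U) (λ k → proj₁ (c k)) p n x))
                     (⊔-ub (U ⇒ U) (λ k → proj₁ (c k)) p n (fun d x)))))

  Fix : Σ (Cont U U) IsDeflation → Pcpo
  Fix (d , (idem , below)) = record
    { Carrier = Σ (Carrier U) (λ u → _≈_ U (fun d u) u)
    ; _⊑_     = λ x y → _⊑_ U (proj₁ x) (proj₁ y)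
    ; ⊑-refl  = ⊑-refl U
    ; ⊑-trans = ⊑-trans U
    ; ⊥       = ⊥ U , (below (⊥ U) , ⊥-least U)
    ; ⊥-least = ⊥-least U
    ; ⊔       = λ c p → ⊔ U (λ n → proj₁ (c n)) p ,
                   (below _ , ⊔-least U _ _ (λ n →
                      ⊑-trans U (proj₂ (proj₂ (c n)))
                        (mono d (⊔-ub U (λ k → proj₁ (c k)) p n))))
    ; ⊔-ub    = λ c p → ⊔-ub U (λ n → proj₁ (c n)) p
    ; ⊔-least = λ c p → ⊔-least U (λ n → proj₁ (c n)) p
    }

  record Rep (α : Pcpo) : Set where
    field
      emb      : Cont α U
      proj     : Cont U α
      proj∘emb : _≈_ (α ⇒ α) (proj ∘c emb) idc
      emb∘proj : _⊑_ (U ⇒ U) (emb ∘c proj) idc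

  open Rep

  RepU : Rep U
  RepU = record
    { emb = idc ; proj = idc
    ; proj∘emb = (λ x → ⊑-refl U) , (λ x → ⊑-refl U)
    ; emb∘proj = λ x → ⊑-refl U }

  coerce : ∀ {α β} → Rep α → Rep β → Cont α β
  coerce Rα Rβ = proj Rβ ∘c emb Rα

  REP : ∀ {α} → Rep α → Carrier Defl
  REP {α} Rα = (emb Rα ∘c proj Rα) ,
    ( ( (λ x → ⊑-trans U (mono (emb Rα) (proj₁ (proj∘emb Rα) (fun (proj Rα) x))) (⊑-refl U))
      , (λ x → mono (emb Rα) (proj₂ (proj∘emb Rα) (fun (proj Rα) x))) )
    , emb∘proj Rα )

  record TypeCon : Set where
    field
      T : Cont Defl Defl

    _·_ : ∀ {α} → Rep α → Pcpo
    _·_ Rα = Fix (fun T (REP Rα))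

    Rep· : ∀ {α} (Rα : Rep α) → Rep (_·_ Rα)
    Rep· Rα = record
      { emb  = record { fun = proj₁ ; mono = λ q → q ; cont = λ c p → ⊑-refl U }
      ; proj = record
          { fun  = λ u → fun d u , proj₁ (proj₂ (fun T (REP Rα))) .proj₁ u , proj₁ (proj₂ (fun T (REP Rα))) .proj₂ u
          ; mono = mono d
          ; cont = cont d }
      ; proj∘emb = (λ x → proj₁ (proj₂ x)) , (λ x → proj₂ (proj₂ x))
      ; emb∘proj = proj₂ (proj₂ (fun T (REP Rα)))
      }
      where
      d : Cont U U
      d = proj₁ (fun T (REP Rα))

  record Functor : Set where
    field
      tycon : TypeCon
    open TypeCon tycon public
    τU : Pcpo
    τU = _·_ RepU
    field
      fmapU : Cont (U ⇒ U) (τU ⇒ τU)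
      F1 : ∀ (d : Carrier Defl) →
           _≈_ (U ⇒ U) (emb (Rep· RepU) ∘c fun fmapU (proj₁ d) ∘c proj (Rep· RepU))
                       (proj₁ (fun T d))
      F2 : ∀ (f g : Cont U U) →
           _≈_ (τU ⇒ τU) (fun fmapU (f ∘c g)) (fun fmapU f ∘c fun fmapU g)

    fmap : ∀ {α β} (Rα : Rep α) (Rβ : Rep β) → Cont α β → Cont (_·_ Rα) (_·_ Rβ)
    fmap Rα Rβ f =
      coerce (Rep· RepU) (Rep· Rβ)
        ∘c fun fmapU (emb Rβ ∘c f ∘c proj Rα)
        ∘c coerce (Rep· Rα) (Rep· RepU)

module Submission where

-- Write F = fmapU and lift(h) = emb_β ∘ h ∘ proj_α : U → U for
-- h : α → β.  Unfolding fmap, the composite fmap(f) ∘ fmap(g) is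
--   (τ·U → τ·γ) ∘ F(lift f) ∘ [τ·β → τ·U] ∘ [τ·U → τ·β] ∘ F(lift g) ∘ (τ·α → τ·U),
-- a chain of coercions and F's.  The bracketed round trip τ·U → τ·β → τ·U is
-- the deflation T(REP β) restricted to τ·U, and by (F1) it equals F(REP β).
-- By (F2) the three resulting F-factors merge into F(lift f ∘ REP β ∘ lift g),
-- and since proj_β ∘ emb_β = id, lifting is functorial:
-- lift f ∘ REP β ∘ lift g ≈ lift (f ∘ g).  What remains is by definition
-- fmap(f ∘ g).

open import Level using (0ℓ)
open import Data.Product using (_×_; _,_; proj₁; proj₂)
open import Relation.Binary.Bundles using (Setoid)
import Relation.Binary.Reasoning.Setoid as SetoidReasoning
open import Defs
open Pcpo using (_≈_)
open Universal using (U)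
open Functor using (_·_; fmap)
open Cont using (fun; mono)
open Rep using (emb; proj; proj∘emb)

≈-setoid : Pcpo → Setoid 0ℓ 0ℓ
≈-setoid A = record
  { Carrier       = Carrier
  ; _≈_           = _≈_ A
  ; isEquivalence = record
    { refl  = ⊑-refl , ⊑-refl
    ; sym   = λ (x⊑y , y⊑x) → y⊑x , x⊑y
    ; trans = λ (x⊑y , y⊑x) (y⊑z , z⊑y) → ⊑-trans x⊑y y⊑z , ⊑-trans z⊑y y⊑x
    }
  }
  where open Pcpo A using (Carrier; ⊑-refl; ⊑-trans)

≈-sym : (A : Pcpo) {x y : Pcpo.Carrier A} → _≈_ A x y → _≈_ A y x
≈-sym A = Setoid.sym (≈-setoid A)

cong-≈ : ∀ {A B} (h : Cont A B) {x y : Pcpo.Carrier A} →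
         _≈_ A x y → _≈_ B (fun h x) (fun h y)
cong-≈ h (x⊑y , y⊑x) = mono h x⊑y , mono h y⊑x

-- The
-- conclusion is written out as the definition of h ≈ k in A ⇒ B, so that the
-- underlying functions h and k can be inferred from the goal.
pointwise : ∀ A B {h k : Pcpo.Carrier A → Pcpo.Carrier B} →
            (∀ x → _≈_ B (h x) (k x)) →
            (∀ x → Pcpo._⊑_ B (h x) (k x)) × (∀ x → Pcpo._⊑_ B (k x) (h x))
pointwise _ _ h≈k = (λ x → proj₁ (h≈k x)) , (λ x → proj₂ (h≈k x))

module Representable {𝕌 : Pcpo} where

  proj∘emb-at : ∀ {α} (R : Rep 𝕌 α) (x : Pcpo.Carrier α) →
                _≈_ α (fun (proj R) (fun (emb R) x)) x
  proj∘emb-at R x = proj₁ (proj∘emb R) x , proj₂ (proj∘emb R) x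

  lift : ∀ {α β} → Rep 𝕌 α → Rep 𝕌 β → Cont α β → Cont 𝕌 𝕌
  lift Rα Rβ h = emb Rβ ∘c h ∘c proj Rα

  -- Lifting is functorial, because proj_β ∘ emb_β = id.  The special case
  -- f = id says REP(β) ∘ lift g ≈ lift g, since REP(β) = lift id.
  lift-∘ : ∀ {α β γ} (Rα : Rep 𝕌 α) (Rβ : Rep 𝕌 β) (Rγ : Rep 𝕌 γ)
           (f : Cont β γ) (g : Cont α β) (u : Pcpo.Carrier 𝕌) →
           _≈_ 𝕌 (fun (lift Rβ Rγ f) (fun (lift Rα Rβ g) u)) (fun (lift Rα Rγ (f ∘c g)) u)
  lift-∘ Rα Rβ Rγ f g u = cong-≈ (emb Rγ ∘c f) (proj∘emb-at Rβ (fun (g ∘c proj Rα) u))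

  lift-∘-through-REP : ∀ {α β γ} (Rα : Rep 𝕌 α) (Rβ : Rep 𝕌 β) (Rγ : Rep 𝕌 γ)
                       (f : Cont β γ) (g : Cont α β) →
                       _≈_ (𝕌 ⇒ 𝕌) (lift Rβ Rγ f ∘c proj₁ (REP 𝕌 Rβ) ∘c lift Rα Rβ g)
                                   (lift Rα Rγ (f ∘c g))
  lift-∘-through-REP Rα Rβ Rγ f g = pointwise 𝕌 𝕌 λ u → begin
      fun (lift Rβ Rγ f) (fun (lift Rβ Rβ idc) (fun (lift Rα Rβ g) u))
    ≈⟨ cong-≈ (lift Rβ Rγ f) (lift-∘ Rα Rβ Rβ idc g u) ⟩
      fun (lift Rβ Rγ f) (fun (lift Rα Rβ g) u)
    ≈⟨ lift-∘ Rα Rβ Rγ f g u ⟩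
      fun (lift Rα Rγ (f ∘c g)) u
    ∎
    where open SetoidReasoning (≈-setoid 𝕌)

open Representable

module FunctorLaws {𝕌 : Pcpo} (τ : Functor 𝕌) where
  open Functor τ using (T; τU; fmapU; F1; F2; Rep·)

  F : Cont 𝕌 𝕌 → Cont τU τU
  F = fun fmapU

  incl : Cont τU 𝕌
  incl = emb (Rep· (RepU 𝕌))

  pU : Cont 𝕌 τU
  pU = proj (Rep· (RepU 𝕌))

  F1-at : (d : Pcpo.Carrier (Defl 𝕌)) (u : Pcpo.Carrier 𝕌) →
          _≈_ 𝕌 (fun incl (fun (F (proj₁ d)) (fun pU u))) (fun (proj₁ (fun T d)) u)
  F1-at d u = proj₁ (F1 d) u , proj₂ (F1 d) u

  F2-at : (a b : Cont 𝕌 𝕌) (w : Pcpo.Carrier τU) →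
          _≈_ τU (fun (F a) (fun (F b) w)) (fun (F (a ∘c b)) w)
  F2-at a b w = proj₂ (F2 a b) w , proj₁ (F2 a b) w

  F-cong : (a b : Cont 𝕌 𝕌) → _≈_ (𝕌 ⇒ 𝕌) a b →
           (w : Pcpo.Carrier τU) → _≈_ τU (fun (F a) w) (fun (F b) w)
  F-cong a b a≈b w = proj₁ (cong-≈ fmapU a≈b) w , proj₂ (cong-≈ fmapU a≈b) w

  -- For every deflation d, applying T(d) to an element of τ·U and projecting
  -- back into τ·U is the same as F(d): this is (F1) read on τ·U, using that
  -- elements of τ·U are fixed by pU.
  round-trip : (d : Pcpo.Carrier (Defl 𝕌)) (w : Pcpo.Carrier τU) →
               _≈_ τU (fun pU (fun (proj₁ (fun T d)) (fun incl w))) (fun (F (proj₁ d)) w)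
  round-trip d w = begin
      fun pU (fun (proj₁ (fun T d)) (fun incl w))
    ≈⟨ cong-≈ pU (≈-sym 𝕌 (F1-at d (fun incl w))) ⟩
      fun pU (fun incl (fun (F (proj₁ d)) (fun pU (fun incl w))))
    ≈⟨ proj∘emb-at (Rep· (RepU 𝕌)) (fun (F (proj₁ d)) (fun pU (fun incl w))) ⟩
      fun (F (proj₁ d)) (fun pU (fun incl w))
    ≈⟨ cong-≈ (F (proj₁ d)) (proj∘emb-at (Rep· (RepU 𝕌)) w) ⟩
      fun (F (proj₁ d)) w
    ∎
    where open SetoidReasoning (≈-setoid τU)

  -- By (F2) and lifting being functorial, F(lift f) ∘ F(REP β) ∘ F(lift g)
  -- collapses to F(lift (f ∘ g)).
  F-lift-∘ : ∀ {α β γ} (Rα : Rep 𝕌 α) (Rβ : Rep 𝕌 β) (Rγ : Rep 𝕌 γ)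
             (f : Cont β γ) (g : Cont α β) (w : Pcpo.Carrier τU) →
             _≈_ τU (fun (F (lift Rβ Rγ f)) (fun (F (proj₁ (REP 𝕌 Rβ))) (fun (F (lift Rα Rβ g)) w)))
                    (fun (F (lift Rα Rγ (f ∘c g))) w)
  F-lift-∘ Rα Rβ Rγ f g w = begin
      fun (F Lf) (fun (F Rβ-defl) (fun (F Lg) w))
    ≈⟨ cong-≈ (F Lf) (F2-at Rβ-defl Lg w) ⟩
      fun (F Lf) (fun (F (Rβ-defl ∘c Lg)) w)
    ≈⟨ F2-at Lf (Rβ-defl ∘c Lg) w ⟩
      fun (F (Lf ∘c Rβ-defl ∘c Lg)) w
    ≈⟨ F-cong _ _ (lift-∘-through-REP Rα Rβ Rγ f g) w ⟩
      fun (F (lift Rα Rγ (f ∘c g))) w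
    ∎
    where
    open SetoidReasoning (≈-setoid τU)
    Lf Lg Rβ-defl : Cont 𝕌 𝕌
    Lf = lift Rβ Rγ f
    Lg = lift Rα Rβ g
    Rβ-defl = proj₁ (REP 𝕌 Rβ)

-- Pointwise, fmap f ∘ fmap g sends x to
--   T(REP γ) (F(lift f) (pU (T(REP β) (F(lift g) (pU x))))):
-- replace the round trip pU ∘ T(REP β) by F(REP β), then collapse the F's.
theorem2 : (𝒰 : Universal) (τ : Functor (U 𝒰))
    {α β γ : Pcpo} (Rα : Rep (U 𝒰) α) (Rβ : Rep (U 𝒰) β) (Rγ : Rep (U 𝒰) γ)
    (f : Cont β γ) (g : Cont α β) →
    _≈_ ((_·_ τ Rα) ⇒ (_·_ τ Rγ))
    (fmap τ Rα Rγ (f ∘c g))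
    (fmap τ Rβ Rγ f ∘c fmap τ Rα Rβ g)
theorem2 𝒰 τ Rα Rβ Rγ f g =
  (λ x → proj₂ (composite≈ x)) , (λ x → proj₁ (composite≈ x))
  where
  𝕌 : Pcpo
  𝕌 = U 𝒰
  open Functor τ using (T; Rep·)
  open FunctorLaws τ
  open SetoidReasoning (≈-setoid (_·_ τ Rγ))
  into-τγ : Cont (Functor.τU τ) (_·_ τ Rγ)
  into-τγ = coerce 𝕌 (Rep· (RepU 𝕌)) (Rep· Rγ)

  composite≈ : ∀ x → _≈_ (_·_ τ Rγ) (fun (fmap τ Rβ Rγ f ∘c fmap τ Rα Rβ g) x)
                                    (fun (fmap τ Rα Rγ (f ∘c g)) x)
  composite≈ x = begin
      fun into-τγ (fun (F Lf) (fun pU (fun (proj₁ (fun T (REP 𝕌 Rβ))) (fun incl (fun (F Lg) y)))))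
    ≈⟨ cong-≈ (into-τγ ∘c F Lf) (round-trip (REP 𝕌 Rβ) (fun (F Lg) y)) ⟩
      fun into-τγ three-factors
    ≈⟨ cong-≈ into-τγ {three-factors} {one-factor} (F-lift-∘ Rα Rβ Rγ f g y) ⟩
      fun into-τγ one-factor
    ∎
    where
    y : Pcpo.Carrier (Functor.τU τ)
    y = fun (coerce 𝕌 (Rep· Rα) (Rep· (RepU 𝕌))) x
    Lf Lg : Cont 𝕌 𝕌
    Lf = lift Rβ Rγ f
    Lg = lift Rα Rβ g
    -- Elements of τ·U are pairs compared through their first component only,
    -- so these points cannot be inferred from the ≈-proof and are named here.
    three-factors one-factor : Pcpo.Carrier (Functor.τU τ)
    three-factors = fun (F Lf) (fun (F (proj₁ (REP 𝕌 Rβ))) (fun (F Lg) y))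
    one-factor    = fun (F (lift Rα Rγ (f ∘c g))) y
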